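{- Let $\Sigma=(X,X_0,S,U,\to,Y,h)$ be an NFTS and $\Sigma_V$ its verification system. Let $(q_0^1,q_0^2)\in X_{V,0}$ and let $$(q_0^1,q_0^2)\xrightarrow{(u_0^1,u_0^2)}_V(q_1^1,q_1^2)\xrightarrow{(u_1^1,u_1^2)}_V\cdots\xrightarrow{(u_{n-1}^1,u_{n-1}^2)}_V(q_n^1,q_n^2)$$ be transitions of $\Sigma_V$ (where $n\ge0$ and each $(u_i^1,u_i^2)\in U_V$). Then (1) $q_n^1=\{x_n\in X\mid \exists x_0,\dots,x_{n-1}\in X:\ x_0\in q_0^1,\ x_i\xrightarrow{u_i^1}x_{i+1}\text{ for all }i\in\{0,\dots,n-1\},\ h(x_i)=h_{V,1}((q_i^1,q_i^2))\text{ for all }i\in\{0,\dots,n\}\}$; (2) $q_n^2=\{x_0\in X\mid \exists x_1,\dots,x_n\in X:\ x_n\in q_0^2,\ x_j\xrightarrow{u^2_{n-1-j}}x_{j+1}\text{ for all }j\in\{0,\dots,n-1\},\ h(x_{n-i})=h_{V,2}((q_i^1,q_i^2))\text{ for all }i\in\{0,\dots,n\}\}$. Here, for $x,x'\in X$, $x\xrightarrow{\epsilon}x'$ means $x'=x$.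
   Context: An NFTS is a tuple $\Sigma=(X,X_0,S,U,\to,Y,h)$ with $X$ a finite set of states, $X_0\subseteq X$ initial states, $S\subseteq X$ secret states, $U$ a finite set of inputs, $\to\subseteq X\times U\times X$ the transition relation (write $x\xrightarrow{u}x'$ for $(x,u,x')\in\to$), $Y$ a set of outputs and $h:X\to Y$. For $y\in Y$ let $X_y=\{x\in X\mid h(x)=y\}$ and $X_{0,y}=X_0\cap X_y$. For $q\subseteq X$ and $u\in U$ let $\mathrm{suc}(q,u)=\{x\in X\mid\exists x'\in q,\ (x',u,x)\in\to\}$ and $\mathrm{post}(q,u)=\{x\in X\mid\exists x'\in q,\ (x,u,x')\in\to\}$. Let $\epsilon$ be a symbol not in $U$. The verification system $\Sigma_V$ has: input set $U_V=(U\times\{\epsilon\})\cup(\{\epsilon\}\times U)$; initial states $X_{V,0}=\{(X_{0,y_1},X_{y_2})\mid y_1,y_2\in Y,\ X_{0,y_1}\neq\emptyset,\ X_{y_2}\neq\emptyset\}$; transitions on pairs $(q_1,q_2)$ of subsets of $X$: $(q_1,q_2)\xrightarrow{(u,\epsilon)}_V(q_1',q_2)$ iff there is $y\in Y$ with $q_1'=\mathrm{suc}(q_1,u)\cap X_y\neq\emptyset$, and $(q_1,q_2)\xrightarrow{(\epsilon,u)}_V(q_1,q_2')$ iff there is $y\in Y$ with $q_2'=\mathrm{post}(q_2,u)\cap X_y\neq\emptyset$; its state set $X_V$ is the set of pairs reachable from $X_{V,0}$ by finitely many such transitions. Every $(q_1,q_2)\in X_V$ has $q_1,q_2$ nonempty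 with $q_1\subseteq X_{y_1}$, $q_2\subseteq X_{y_2}$ for unique $y_1,y_2\in Y$, and one sets $h_{V,1}((q_1,q_2))=y_1$, $h_{V,2}((q_1,q_2))=y_2$. -}

module Defs where

open import Level using (0ℓ)
open import Data.Nat using (ℕ)
open import Data.Fin using (Fin)
open import Data.Maybe using (Maybe; just; nothing)
open import Data.Sum using (_⊎_; inj₁; inj₂)
open import Data.Product using (_×_; _,_; ∃; ∃₂; proj₁; proj₂)
open import Relation.Unary using (Pred; _∩_; _⊆_; _≐_; Satisfiable)
open import Relation.Binary.PropositionalEquality using (_≡_)

-- A nondeterministic finite transition system (NFTS).
-- X = Fin nX (finite state set), U = Fin nU (finite input set),
-- subsets of X are predicates on X; equality of subsets is extensional (_≐_).
record NFTS : Set₁ where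
  field
    nX  : ℕ
    nU  : ℕ
    X₀  : Pred (Fin nX) 0ℓ
    S   : Pred (Fin nX) 0ℓ
    _⟶[_]_ : Fin nX → Fin nU → Fin nX → Set
    Y   : Set
    h   : Fin nX → Y

module _ (N : NFTS) where
  open NFTS N

  St : Set
  St = Fin nX

  In : Set
  In = Fin nU

  Sub : Set₁
  Sub = Pred St 0ℓ

  Xy : Y → Sub
  Xy y = λ x → h x ≡ y

  X0y : Y → Sub
  X0y y = X₀ ∩ Xy y

  sucS : Sub → In → Sub
  sucS q u = λ x → ∃ λ x' → q x' × (x' ⟶[ u ] x)

  postS : Sub → In → Sub
  postS q u = λ x → ∃ λ x' → q x' × (x ⟶[ u ] x')

  -- U_V = (U × {ε}) ∪ ({ε} × U): inj₁ u = (u,ε), inj₂ u = (ε,u)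
  UV : Set
  UV = In ⊎ In

  -- first / second component of an element of U_V (nothing = ε)
  comp₁ : UV → Maybe In
  comp₁ (inj₁ u) = just u
  comp₁ (inj₂ _) = nothing

  comp₂ : UV → Maybe In
  comp₂ (inj₁ _) = nothing
  comp₂ (inj₂ u) = just u

  _⟶ε[_]_ : St → Maybe In → St → Set
  x ⟶ε[ just u ] x' = x ⟶[ u ] x'
  x ⟶ε[ nothing ] x' = x' ≡ x

  VSt : Set₁
  VSt = Sub × Sub

  InitV : VSt → Set
  InitV (q₁ , q₂) = ∃₂ λ y₁ y₂ →
    Satisfiable (X0y y₁) × Satisfiable (Xy y₂) × (q₁ ≐ X0y y₁) × (q₂ ≐ Xy y₂)

  StepV : VSt → UV → VSt → Set
  StepV (q₁ , q₂) (inj₁ u) (q₁' , q₂') =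
    (∃ λ y → Satisfiable (sucS q₁ u ∩ Xy y) × (q₁' ≐ (sucS q₁ u ∩ Xy y))) × (q₂' ≐ q₂)
  StepV (q₁ , q₂) (inj₂ u) (q₁' , q₂') =
    (∃ λ y → Satisfiable (postS q₂ u ∩ Xy y) × (q₂' ≐ (postS q₂ u ∩ Xy y))) × (q₁' ≐ q₁)

  -- "h_{V,1}(q) = y" : q₁ is nonempty and q₁ ⊆ X_y (y is then unique)
  HV₁≡ : VSt → Y → Set
  HV₁≡ (q₁ , q₂) y = Satisfiable q₁ × (q₁ ⊆ Xy y)

  HV₂≡ : VSt → Y → Set
  HV₂≡ (q₁ , q₂) y = Satisfiable q₂ × (q₂ ⊆ Xy y)

-- The first components of a run q₀ → … → qₙ of Σ_V form an "image
-- sequence": each q¹ᵢ₊₁ is the image of q¹ᵢ under the i-th input, cut down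
-- to the states carrying the label of q¹ᵢ₊₁.  The second components, read
-- from qₙ back to q₀, form a "preimage sequence" in the same sense for the
-- reversed transitions.  Claim (1) is then the image
-- lemma, and claim (2) the preimage lemma after reindexing the run by
-- 'opposite'.
module Submission where

open import Defs
open import Level using (0ℓ)
open import Data.Nat using (ℕ; zero; suc)
open import Data.Fin using (Fin; zero; suc; inject₁; fromℕ; opposite)
open import Data.Fin.Properties using (opposite-involutive)
open import Data.Fin.Induction using (<-weakInduction)
open import Data.Vec.Functional using (_∷_)
open import Data.Sum using (inj₁; inj₂)
open import Data.Product using (_×_; _,_; ∃; proj₁; proj₂)
open import Relation.Unary using (Pred; _⊆_; _≐_; Satisfiable)
open import Relation.Binary.PropositionalEquality
  using (_≡_; refl; sym; trans; subst; cong; module ≡-Reasoning)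

opposite-inject₁ : ∀ {n} (j : Fin n) → opposite (inject₁ j) ≡ suc (opposite j)
opposite-inject₁ j = begin
  opposite (inject₁ j)                       ≡⟨ cong (λ k → opposite (inject₁ k)) (sym (opposite-involutive j)) ⟩
  opposite (opposite (suc (opposite j)))     ≡⟨ opposite-involutive (suc (opposite j)) ⟩
  suc (opposite j)                           ∎
  where open ≡-Reasoning

opposite-swap : ∀ {n} (T : Fin n → Fin n → Set) →
  (∀ i → T (opposite i) i) → ∀ i → T i (opposite i)
opposite-swap T t i = subst (λ k → T k (opposite i)) (opposite-involutive i) (t (opposite i))

module _ {A : Set} where

  Chain : ∀ {n} → (Fin n → A → A → Set) → (Fin (suc n) → A) → Set
  Chain R x = ∀ i → R i (x (inject₁ i)) (x (suc i))

  record ImageSequence {n} (Q : Fin (suc n) → Pred A 0ℓ)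
                       (R : Fin n → A → A → Set) (P : Fin (suc n) → A → Set) : Set where
    field
      guarded     : ∀ i {z} → Q i z → P i z
      predecessor : ∀ i {z'} → Q (suc i) z' → ∃ λ z → Q (inject₁ i) z × R i z z'
      successor   : ∀ i {z z'} → Q (inject₁ i) z → R i z z' → P (suc i) z' → Q (suc i) z'

  record PreimageSequence {n} (Q : Fin (suc n) → Pred A 0ℓ)
                          (R : Fin n → A → A → Set) (P : Fin (suc n) → A → Set) : Set where
    field
      guarded     : ∀ i {z} → Q i z → P i z
      successor   : ∀ i {z} → Q (inject₁ i) z → ∃ λ z' → Q (suc i) z' × R i z z'
      predecessor : ∀ i {z z'} → Q (suc i) z' → R i z z' → P (inject₁ i) z → Q (inject₁ i) z

  shiftImage : ∀ {n Q R P} → ImageSequence {suc n} Q R P →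
    ImageSequence (λ i → Q (suc i)) (λ i → R (suc i)) (λ i → P (suc i))
  shiftImage S = record
    { guarded = λ i → guarded (suc i) ; predecessor = λ i → predecessor (suc i)
    ; successor = λ i → successor (suc i) }
    where open ImageSequence S

  shiftPreimage : ∀ {n Q R P} → PreimageSequence {suc n} Q R P →
    PreimageSequence (λ i → Q (suc i)) (λ i → R (suc i)) (λ i → P (suc i))
  shiftPreimage S = record
    { guarded = λ i → guarded (suc i) ; successor = λ i → successor (suc i)
    ; predecessor = λ i → predecessor (suc i) }
    where open PreimageSequence S

  PathEnds : ∀ {n} → (Fin (suc n) → Pred A 0ℓ) → (Fin n → A → A → Set) →
    (Fin (suc n) → A → Set) → Pred A 0ℓ
  PathEnds {n} Q R P xₙ = ∃ λ (x : Fin (suc n) → A) →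
    (x (fromℕ n) ≡ xₙ) × Q zero (x zero) × Chain R x × (∀ i → P i (x i))

  PathStarts : ∀ {n} → (Fin (suc n) → Pred A 0ℓ) → (Fin n → A → A → Set) →
    (Fin (suc n) → A → Set) → Pred A 0ℓ
  PathStarts {n} Q R P x₀ = ∃ λ (x : Fin (suc n) → A) →
    (x zero ≡ x₀) × Q (fromℕ n) (x (fromℕ n)) × Chain R x × (∀ i → P i (x i))

  image-complete : ∀ {n Q R P} → ImageSequence {n} Q R P → Q (fromℕ n) ⊆ PathEnds Q R P
  image-complete {zero} S {xₙ} m =
    (λ _ → xₙ) , refl , m , (λ ()) , λ { zero → ImageSequence.guarded S zero m }
  image-complete {suc n} {Q} {R} {P} S m with image-complete (shiftImage S) m
  ... | x , x-end , x-start , chain , guards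
    with ImageSequence.predecessor S zero x-start
  ... | z , z∈Q₀ , z⟶x₀ = (z ∷ x) , x-end , z∈Q₀ , chain′ , guards′
    where
    chain′ : Chain R (z ∷ x)
    chain′ zero    = z⟶x₀
    chain′ (suc i) = chain i
    guards′ : ∀ i → P i ((z ∷ x) i)
    guards′ zero    = ImageSequence.guarded S zero z∈Q₀
    guards′ (suc i) = guards i

  image-sound : ∀ {n Q R P} → ImageSequence {n} Q R P → PathEnds Q R P ⊆ Q (fromℕ n)
  image-sound {zero} S (x , refl , m , _ , _) = m
  image-sound {suc n} S (x , x-end , m , chain , guards) =
    image-sound (shiftImage S)
      ( (λ i → x (suc i)) , x-end
      , ImageSequence.successor S zero m (chain zero) (guards (suc zero))
      , (λ i → chain (suc i)) , (λ i → guards (suc i)) )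

  last-stage : ∀ {n Q R P} → ImageSequence {n} Q R P → Q (fromℕ n) ≐ PathEnds Q R P
  last-stage S = image-complete S , image-sound S

  preimage-complete : ∀ {n Q R P} → PreimageSequence {n} Q R P → Q zero ⊆ PathStarts Q R P
  preimage-complete {zero} S {x₀} m =
    (λ _ → x₀) , refl , m , (λ ()) , λ { zero → PreimageSequence.guarded S zero m }
  preimage-complete {suc n} {Q} {R} {P} S {x₀} m with PreimageSequence.successor S zero m
  ... | z' , z'∈Q₁ , x₀⟶z'
    with preimage-complete (shiftPreimage S) z'∈Q₁
  ... | x , refl , x-end , chain , guards = (x₀ ∷ x) , refl , x-end , chain′ , guards′
    where
    chain′ : Chain R (x₀ ∷ x)
    chain′ zero    = x₀⟶z'
    chain′ (suc i) = chain i
    guards′ : ∀ i → P i ((x₀ ∷ x) i)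
    guards′ zero    = PreimageSequence.guarded S zero m
    guards′ (suc i) = guards i

  preimage-sound : ∀ {n Q R P} → PreimageSequence {n} Q R P → PathStarts Q R P ⊆ Q zero
  preimage-sound {zero} S (x , refl , m , _ , _) = m
  preimage-sound {suc n} S (x , refl , m , chain , guards) =
    PreimageSequence.predecessor S zero
      (preimage-sound (shiftPreimage S)
        ((λ i → x (suc i)) , refl , m , (λ i → chain (suc i)) , (λ i → guards (suc i))))
      (chain zero) (guards zero)

  first-stage : ∀ {n Q R P} → PreimageSequence {n} Q R P → Q zero ≐ PathStarts Q R P
  first-stage S = preimage-complete S , preimage-sound S

module _ (N : NFTS) where
  open NFTS N using (h)

  Uniform : Sub N → Set
  Uniform q = ∃ λ y → q ⊆ Xy N y

  UniformState : VSt N → Set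
  UniformState (q₁ , q₂) = Uniform q₁ × Uniform q₂

  label-unique : ∀ {q : Sub N} {y y'} → Satisfiable q → q ⊆ Xy N y → q ⊆ Xy N y' → y' ≡ y
  label-unique (z , z∈q) q⊆y q⊆y' = trans (sym (q⊆y' z∈q)) (q⊆y z∈q)

  member-label : ∀ {q : Sub N} {x} → Uniform q → q x → Satisfiable q × (q ⊆ Xy N (h x))
  member-label (y , q⊆y) x∈q = (_ , x∈q) , λ z∈q → trans (q⊆y z∈q) (sym (q⊆y x∈q))

  init-uniform : ∀ {a} → InitV N a → UniformState a
  init-uniform (y₁ , y₂ , _ , _ , q₁≐ , q₂≐) = (y₁ , λ m → proj₂ (proj₁ q₁≐ m)) , (y₂ , proj₁ q₂≐)

  step-uniform : ∀ {a b} v → StepV N a v b → UniformState a → UniformState b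
  step-uniform (inj₁ u) ((y , _ , q₁'≐) , q₂'≐) (_ , (y₂ , q₂⊆)) =
    (y , λ m → proj₂ (proj₁ q₁'≐ m)) , (y₂ , λ m → q₂⊆ (proj₁ q₂'≐ m))
  step-uniform (inj₂ u) ((y , _ , q₂'≐) , q₁'≐) ((y₁ , q₁⊆) , _) =
    (y₁ , λ m → q₁⊆ (proj₁ q₁'≐ m)) , (y , λ m → proj₂ (proj₁ q₂'≐ m))

  step₁-back : ∀ {a b} v → StepV N a v b → ∀ {z'} → proj₁ b z' →
    ∃ λ z → proj₁ a z × _⟶ε[_]_ N z (comp₁ N v) z'
  step₁-back (inj₁ u) ((_ , _ , q₁'≐) , _) m = proj₁ (proj₁ q₁'≐ m)
  step₁-back (inj₂ u) (_ , q₁'≐) m = _ , proj₁ q₁'≐ m , refl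

  step₁-forth : ∀ {a b} v → StepV N a v b → ∀ {z z'} → proj₁ a z →
    _⟶ε[_]_ N z (comp₁ N v) z' → HV₁≡ N b (h z') → proj₁ b z'
  step₁-forth (inj₁ u) ((_ , _ , q₁'≐) , _) m t (nonempty , q₁'⊆) =
    proj₂ q₁'≐ ((_ , m , t) , label-unique nonempty (λ m' → proj₂ (proj₁ q₁'≐ m')) q₁'⊆)
  step₁-forth (inj₂ u) (_ , q₁'≐) m refl _ = proj₂ q₁'≐ m

  step₂-back : ∀ {a b} v → StepV N a v b → ∀ {z} → proj₂ b z →
    ∃ λ z' → proj₂ a z' × _⟶ε[_]_ N z (comp₂ N v) z'
  step₂-back (inj₂ u) ((_ , _ , q₂'≐) , _) m = proj₁ (proj₁ q₂'≐ m)
  step₂-back (inj₁ u) (_ , q₂'≐) m = _ , proj₁ q₂'≐ m , refl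

  step₂-forth : ∀ {a b} v → StepV N a v b → ∀ {z z'} → proj₂ a z' →
    _⟶ε[_]_ N z (comp₂ N v) z' → HV₂≡ N b (h z) → proj₂ b z
  step₂-forth (inj₂ u) ((_ , _ , q₂'≐) , _) m t (nonempty , q₂'⊆) =
    proj₂ q₂'≐ ((_ , m , t) , label-unique nonempty (λ m' → proj₂ (proj₁ q₂'≐ m')) q₂'⊆)
  step₂-forth (inj₁ u) (_ , q₂'≐) m refl _ = proj₂ q₂'≐ m

  module Run {n} (q : Fin (suc n) → VSt N) (u : Fin n → UV N) (init : InitV N (q zero))
             (steps : ∀ i → StepV N (q (inject₁ i)) (u i) (q (suc i))) where

    reachable-uniform : ∀ i → UniformState (q i)
    reachable-uniform = <-weakInduction (λ i → UniformState (q i)) (init-uniform init)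
      (λ i → step-uniform (u i) (steps i))

    first-components : ImageSequence (λ i → proj₁ (q i))
      (λ i z z' → _⟶ε[_]_ N z (comp₁ N (u i)) z') (λ i z → HV₁≡ N (q i) (h z))
    first-components = record
      { guarded     = λ i → member-label (proj₁ (reachable-uniform i))
      ; predecessor = λ i → step₁-back (u i) (steps i)
      ; successor   = λ i → step₁-forth (u i) (steps i) }

    reversed-step : ∀ j → StepV N (q (opposite (suc j))) (u (opposite j)) (q (opposite (inject₁ j)))
    reversed-step j = subst (λ k → StepV N (q (opposite (suc j))) (u (opposite j)) (q k))
      (sym (opposite-inject₁ j)) (steps (opposite j))

    second-components : PreimageSequence (λ j → proj₂ (q (opposite j)))
      (λ j z z' → _⟶ε[_]_ N z (comp₂ N (u (opposite j))) z') (λ j z → HV₂≡ N (q (opposite j)) (h z))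
    second-components = record
      { guarded     = λ j → member-label (proj₂ (reachable-uniform (opposite j)))
      ; successor   = λ j → step₂-back (u (opposite j)) (reversed-step j)
      ; predecessor = λ j → step₂-forth (u (opposite j)) (reversed-step j) }

    ReversedPathStarts : Pred (St N) 0ℓ
    ReversedPathStarts x₀ = ∃ λ (x : Fin (suc n) → St N) →
      (x zero ≡ x₀) × proj₂ (q zero) (x (fromℕ n)) ×
      (∀ (j : Fin n) → _⟶ε[_]_ N (x (inject₁ j)) (comp₂ N (u (opposite j))) (x (suc j))) ×
      (∀ (i : Fin (suc n)) → HV₂≡ N (q i) (h (x (opposite i))))

    second-claim : proj₂ (q (fromℕ n)) ≐ ReversedPathStarts
    second-claim = to , from
      where
      opposite-last : opposite (fromℕ n) ≡ zero
      opposite-last = opposite-involutive zero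
      to : proj₂ (q (fromℕ n)) ⊆ ReversedPathStarts
      to m with proj₁ (first-stage second-components) m
      ... | x , x-start , x-end , chain , guards =
        x , x-start , subst (λ k → proj₂ (q k) (x (fromℕ n))) opposite-last x-end , chain ,
        opposite-swap (λ i j → HV₂≡ N (q i) (h (x j))) guards
      from : ReversedPathStarts ⊆ proj₂ (q (fromℕ n))
      from (x , x-start , x-end , chain , guards) = proj₂ (first-stage second-components)
        ( x , x-start , subst (λ k → proj₂ (q k) (x (fromℕ n))) (sym opposite-last) x-end , chain
        , opposite-swap (λ i j → HV₂≡ N (q j) (h (x i))) guards )

proposition5p1 : (N : NFTS) (n : ℕ) (q : Fin (suc n) → VSt N) (u : Fin n → UV N) →
    InitV N (q zero) →
    (∀ (i : Fin n) → StepV N (q (inject₁ i)) (u i) (q (suc i))) →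
    (proj₁ (q (fromℕ n)) ≐ (λ xₙ → ∃ λ (x : Fin (suc n) → St N) →
        (x (fromℕ n) ≡ xₙ) × proj₁ (q zero) (x zero) ×
        (∀ (i : Fin n) → _⟶ε[_]_ N (x (inject₁ i)) (comp₁ N (u i)) (x (suc i))) ×
        (∀ (i : Fin (suc n)) → HV₁≡ N (q i) (NFTS.h N (x i)))))
    ×
    (proj₂ (q (fromℕ n)) ≐ (λ x₀ → ∃ λ (x : Fin (suc n) → St N) →
        (x zero ≡ x₀) × proj₂ (q zero) (x (fromℕ n)) ×
        (∀ (j : Fin n) → _⟶ε[_]_ N (x (inject₁ j)) (comp₂ N (u (opposite j))) (x (suc j))) ×
        (∀ (i : Fin (suc n)) → HV₂≡ N (q i) (NFTS.h N (x (opposite i))))))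
proposition5p1 N n q u init steps = last-stage first-components , second-claim
  where open Run N q u init steps
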